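{- Let $n\ge 1$ and suppose that $\mathcal A,\mathcal B\subset 2^{[n]}$ are cross-IU. Then $|\mathcal A|\,|\mathcal B|\le 2^{2n-4}$.
   Context: Families $\mathcal A,\mathcal B\subset 2^{[n]}$ are cross-IU if for all $A\in\mathcal A$ and $B\in\mathcal B$ we have both $A\cap B\ne\emptyset$ and $A\cup B\ne[n]$. -}

module Defs where

open import Data.Fin.Subset using (Subset; _∩_; _∪_; ⊥; ⊤)
open import Data.List using (List)
open import Data.List.Membership.Propositional using (_∈_)
open import Relation.Binary.PropositionalEquality using (_≢_)

-- A family 𝒜 ⊆ 2^[n] is represented by a duplicate-free list of subsets
-- (duplicate-freeness is imposed in the statement), so |𝒜| = length.

CrossIU : ∀ {n} → List (Subset n) → List (Subset n) → Set
CrossIU 𝒜 ℬ = ∀ {A B} → A ∈ 𝒜 → B ∈ ℬ → (A ∩ B ≢ ⊥) × (A ∪ B ≢ ⊤)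
  where open import Data.Product using (_×_)

-- Replace 𝒜 by its up-closure U and down-closure D. Then 𝒜 ⊆ U ∩ D, and the
-- Harris–Kleitman inequality (an up-set and a down-set are negatively
-- correlated) gives 2ⁿ |𝒜| ≤ |U| |D|. Cross-intersection means that no set of
-- U𝒜 has its complement in Uℬ, so |U𝒜| + |Uℬ| ≤ 2ⁿ; dually cross-union gives
-- |D𝒜| + |Dℬ| ≤ 2ⁿ. By AM–GM each product |U𝒜| |Uℬ| and |D𝒜| |Dℬ| is at most
-- 2²ⁿ⁻², so 2²ⁿ |𝒜| |ℬ| ≤ |U𝒜| |D𝒜| |Uℬ| |Dℬ| ≤ 2⁴ⁿ⁻⁴.
module Submission where

open import Defs
open import Data.Nat using (ℕ; _≤_; _*_; _^_)
open import Data.Fin.Subset using (Subset)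
open import Data.List using (List; length)
open import Data.List.Relation.Unary.Unique.Propositional using (Unique)

open import Data.Nat using (zero; suc; _+_; z≤n; NonZero)
open import Data.Nat.Properties
open import Algebra.Properties.CommutativeSemigroup +-commutativeSemigroup using (interchange)
open import Data.Nat.Tactic.RingSolver using (solve-∀)
open import Data.Bool using (Bool; true; false; T; _∧_)
open import Data.Bool.Properties as Bool using (T-∧)
open import Data.Vec using ([]; _∷_)
open import Data.Fin.Subset using (_⊆_; _∩_; _∪_; ∁; ⊤; ⊥; inside; outside)
open import Data.Fin.Subset.Properties
open import Data.List using ([]; _∷_)
open import Data.List.Relation.Unary.All as All using (All; []; _∷_)
open import Data.List.Relation.Unary.Any as Any using (Any; any?)
open import Data.List.Membership.Propositional using (_∈_; find; lose)
open import Data.List.Relation.Unary.AllPairs using ([]; _∷_)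
import Data.Sum as Sum
open import Data.Product using (_,_; proj₁; proj₂)
open import Data.Empty using (⊥-elim) renaming (⊥ to Empty)
open import Data.Unit using (tt)
open import Function using (_∘_; Equivalence)
open import Relation.Nullary using (yes; no; isYes)
open import Relation.Nullary.Decidable using (toWitness; fromWitness)
open import Relation.Binary.PropositionalEquality

private
  variable
    n : ℕ

chebyshev-opposite : ∀ {a₀ a₁ b₀ b₁} → a₀ ≤ a₁ → b₁ ≤ b₀ →
  2 * (a₀ * b₀ + a₁ * b₁) ≤ (a₀ + a₁) * (b₀ + b₁)
chebyshev-opposite {a₀} {b₁ = b₁} a₀≤a₁ b₁≤b₀ with m≤n⇒∃[o]m+o≡n a₀≤a₁ | m≤n⇒∃[o]m+o≡n b₁≤b₀
... | p , refl | q , refl = ≤-trans (m≤m+n _ (p * q)) (≤-reflexive (defect a₀ p b₁ q))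
  where
  defect : ∀ a p b q → 2 * (a * (b + q) + (a + p) * b) + p * q ≡ (a + (a + p)) * ((b + q) + b)
  defect = solve-∀

am-gm : ∀ m n → 4 * (m * n) ≤ (m + n) * (m + n)
am-gm m n = Sum.[ ordered , swapped ]′ (≤-total m n)
  where
  ordered : ∀ {m n} → m ≤ n → 4 * (m * n) ≤ (m + n) * (m + n)
  ordered {m} m≤n with m≤n⇒∃[o]m+o≡n m≤n
  ... | d , refl = ≤-trans (m≤m+n _ (d * d)) (≤-reflexive (defect m d))
    where
    defect : ∀ m d → 4 * (m * (m + d)) + d * d ≡ (m + (m + d)) * (m + (m + d))
    defect = solve-∀
  swapped : n ≤ m → 4 * (m * n) ≤ (m + n) * (m + n)
  swapped n≤m = subst₂ _≤_ (cong (4 *_) (*-comm n m)) (cong (λ k → k * k) (+-comm n m)) (ordered n≤m)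

product-bound : ∀ {N a b} .{{_ : NonZero N}} u u′ d d′ →
  N * a ≤ u * d → N * b ≤ u′ * d′ → u + u′ ≤ N → d + d′ ≤ N → 16 * (a * b) ≤ N * N
product-bound {N} {a} {b} u u′ d d′ Na≤ud Nb≤u′d′ u+u′≤N d+d′≤N =
  *-cancelˡ-≤ N (*-cancelˡ-≤ N (begin
    N * (N * (16 * (a * b)))        ≡⟨ regroup₁ N a b ⟩
    16 * ((N * a) * (N * b))        ≤⟨ *-monoʳ-≤ 16 (*-mono-≤ Na≤ud Nb≤u′d′) ⟩
    16 * ((u * d) * (u′ * d′))      ≡⟨ regroup₂ u d u′ d′ ⟩
    (4 * (u * u′)) * (4 * (d * d′)) ≤⟨ *-mono-≤ (am-gm-≤ u u′ u+u′≤N) (am-gm-≤ d d′ d+d′≤N) ⟩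
    (N * N) * (N * N)               ≡⟨ *-assoc N N (N * N) ⟩
    N * (N * (N * N))               ∎))
  where
  open ≤-Reasoning
  am-gm-≤ : ∀ m k → m + k ≤ N → 4 * (m * k) ≤ N * N
  am-gm-≤ m k m+k≤N = ≤-trans (am-gm m k) (*-mono-≤ m+k≤N m+k≤N)
  regroup₁ : ∀ N a b → N * (N * (16 * (a * b))) ≡ 16 * ((N * a) * (N * b))
  regroup₁ = solve-∀
  regroup₂ : ∀ u d u′ d′ → 16 * ((u * d) * (u′ * d′)) ≡ (4 * (u * u′)) * (4 * (d * d′))
  regroup₂ = solve-∀

count : (Subset n → Bool) → ℕ
count {zero}  P with P []
... | true  = 1
... | false = 0
count {suc n} P = count (P ∘ (outside ∷_)) + count (P ∘ (inside ∷_))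

count-mono : {P Q : Subset n → Bool} → (∀ x → T (P x) → T (Q x)) → count P ≤ count Q
count-mono {zero} {P} {Q} P⇒Q with P [] | Q [] | P⇒Q []
... | false | _     | _      = z≤n
... | true  | true  | _      = ≤-refl
... | true  | false | P⇒Q[] = ⊥-elim (P⇒Q[] tt)
count-mono {suc n} P⇒Q = +-mono-≤ (count-mono (P⇒Q ∘ (outside ∷_))) (count-mono (P⇒Q ∘ (inside ∷_)))

count-∘∁ : (P : Subset n → Bool) → count (P ∘ ∁) ≡ count P
count-∘∁ {zero}  P = refl
count-∘∁ {suc n} P =
  trans (cong₂ _+_ (count-∘∁ (P ∘ (inside ∷_))) (count-∘∁ (P ∘ (outside ∷_))))
        (+-comm (count (P ∘ (inside ∷_))) (count (P ∘ (outside ∷_))))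

count-disjoint : {P Q : Subset n → Bool} → (∀ x → T (P x) → T (Q x) → Empty) →
  count P + count Q ≤ 2 ^ n
count-disjoint {zero} {P} {Q} disjoint with P [] | Q [] | disjoint []
... | false | false | _          = z≤n
... | false | true  | _          = ≤-refl
... | true  | false | _          = ≤-refl
... | true  | true  | disjoint[] = ⊥-elim (disjoint[] tt tt)
count-disjoint {suc n} {P} {Q} disjoint = begin
  (p₀ + p₁) + (q₀ + q₁) ≡⟨ interchange p₀ p₁ q₀ q₁ ⟩
  (p₀ + q₀) + (p₁ + q₁) ≤⟨ +-mono-≤ (count-disjoint (disjoint ∘ (outside ∷_)))
                                    (count-disjoint (disjoint ∘ (inside ∷_))) ⟩
  2 ^ n + 2 ^ n         ≡⟨ cong (2 ^ n +_) (sym (+-identityʳ (2 ^ n))) ⟩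
  2 ^ suc n             ∎
  where
  open ≤-Reasoning
  p₀ = count (P ∘ (outside ∷_))
  p₁ = count (P ∘ (inside ∷_))
  q₀ = count (Q ∘ (outside ∷_))
  q₁ = count (Q ∘ (inside ∷_))

count-antipodal-free : {P Q : Subset n → Bool} → (∀ x → T (P x) → T (Q (∁ x)) → Empty) →
  count P + count Q ≤ 2 ^ n
count-antipodal-free {n} {P} {Q} antipodal-free =
  subst (λ k → count P + k ≤ 2 ^ n) (count-∘∁ Q) (count-disjoint antipodal-free)

UpSet DownSet : (Subset n → Bool) → Set
UpSet   P = ∀ {x y} → x ⊆ y → T (P x) → T (P y)
DownSet P = ∀ {x y} → x ⊆ y → T (P y) → T (P x)

-- On the two halves x₁ = 0 and x₁ = 1 the up-set grows while the down-set
-- shrinks, so Chebyshev's inequality combines the two inductive bounds.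
harris-kleitman : {U D : Subset n → Bool} → UpSet U → DownSet D →
  2 ^ n * count (λ x → U x ∧ D x) ≤ count U * count D
harris-kleitman {zero} {U} {D} _ _ with U [] | D []
... | true  | true  = ≤-refl
... | true  | false = z≤n
... | false | _     = z≤n
harris-kleitman {suc n} {U} {D} up down = begin
  2 ^ suc n * (c₀ + c₁)         ≡⟨ *-assoc 2 (2 ^ n) (c₀ + c₁) ⟩
  2 * (2 ^ n * (c₀ + c₁))       ≡⟨ cong (2 *_) (*-distribˡ-+ (2 ^ n) c₀ c₁) ⟩
  2 * (2 ^ n * c₀ + 2 ^ n * c₁) ≤⟨ *-monoʳ-≤ 2 (+-mono-≤ (harris-kleitman (up ∘ s⊆s) (down ∘ s⊆s))
                                                         (harris-kleitman (up ∘ s⊆s) (down ∘ s⊆s))) ⟩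
  2 * (u₀ * d₀ + u₁ * d₁)       ≤⟨ chebyshev-opposite (count-mono (λ x → up (out⊆ {q = x} ⊆-refl)))
                                                      (count-mono (λ x → down (out⊆ {q = x} ⊆-refl))) ⟩
  (u₀ + u₁) * (d₀ + d₁)         ∎
  where
  open ≤-Reasoning
  c₀ = count (λ x → U (outside ∷ x) ∧ D (outside ∷ x))
  c₁ = count (λ x → U (inside ∷ x) ∧ D (inside ∷ x))
  u₀ = count (U ∘ (outside ∷_))
  u₁ = count (U ∘ (inside ∷_))
  d₀ = count (D ∘ (outside ∷_))
  d₁ = count (D ∘ (inside ∷_))

withHead : Bool → List (Subset (suc n)) → List (Subset n)
withHead b [] = []
withHead b ((c ∷ x) ∷ xs) with c Bool.≟ b
... | yes _ = x ∷ withHead b xs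
... | no  _ = withHead b xs

length-withHead : (xs : List (Subset (suc n))) →
  length xs ≡ length (withHead outside xs) + length (withHead inside xs)
length-withHead [] = refl
length-withHead ((outside ∷ x) ∷ xs) = cong suc (length-withHead xs)
length-withHead ((inside ∷ x) ∷ xs) = trans (cong suc (length-withHead xs)) (sym (+-suc _ _))

All-withHead : {P : Subset (suc n) → Set} (b : Bool) {xs : List (Subset (suc n))} →
  All P xs → All (P ∘ (b ∷_)) (withHead b xs)
All-withHead b [] = []
All-withHead b {(c ∷ x) ∷ xs} (px ∷ pxs) with c Bool.≟ b
... | yes refl = px ∷ All-withHead b pxs
... | no  _    = All-withHead b pxs

Unique-withHead : (b : Bool) {xs : List (Subset (suc n))} → Unique xs → Unique (withHead b xs)
Unique-withHead b [] = []
Unique-withHead b {(c ∷ x) ∷ xs} (x∉xs ∷ unique) with c Bool.≟ b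
... | yes refl = All.map (λ x≢y → x≢y ∘ cong (c ∷_)) (All-withHead b x∉xs) ∷ Unique-withHead b unique
... | no  _    = Unique-withHead b unique

length≤count : {P : Subset n → Bool} {xs : List (Subset n)} →
  Unique xs → All (T ∘ P) xs → length xs ≤ count P
length≤count {zero} {xs = []} _ _ = z≤n
length≤count {zero} {P} {[] ∷ []} _ (P[] ∷ []) with P []
... | true = ≤-refl
length≤count {zero} {xs = [] ∷ [] ∷ _} ((x≢y ∷ _) ∷ _) _ = ⊥-elim (x≢y refl)
length≤count {suc n} {P} {xs} unique Pxs = begin
  length xs
    ≡⟨ length-withHead xs ⟩
  length (withHead outside xs) + length (withHead inside xs)
    ≤⟨ +-mono-≤ (length≤count (Unique-withHead outside unique) (All-withHead outside Pxs))
                (length≤count (Unique-withHead inside unique) (All-withHead inside Pxs)) ⟩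
  count P
    ∎
  where open ≤-Reasoning

upClosure downClosure : List (Subset n) → Subset n → Bool
upClosure   𝒜 x = isYes (any? (_⊆? x) 𝒜)
downClosure 𝒜 x = isYes (any? (x ⊆?_) 𝒜)

upClosure-intro : {𝒜 : List (Subset n)} {x : Subset n} → Any (_⊆ x) 𝒜 → T (upClosure 𝒜 x)
upClosure-intro {𝒜 = 𝒜} {x} = fromWitness {a? = any? (_⊆? x) 𝒜}

upClosure-elim : {𝒜 : List (Subset n)} {x : Subset n} → T (upClosure 𝒜 x) → Any (_⊆ x) 𝒜
upClosure-elim {𝒜 = 𝒜} {x} = toWitness {a? = any? (_⊆? x) 𝒜}

downClosure-intro : {𝒜 : List (Subset n)} {x : Subset n} → Any (x ⊆_) 𝒜 → T (downClosure 𝒜 x)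
downClosure-intro {𝒜 = 𝒜} {x} = fromWitness {a? = any? (x ⊆?_) 𝒜}

downClosure-elim : {𝒜 : List (Subset n)} {x : Subset n} → T (downClosure 𝒜 x) → Any (x ⊆_) 𝒜
downClosure-elim {𝒜 = 𝒜} {x} = toWitness {a? = any? (x ⊆?_) 𝒜}

upClosure-upSet : (𝒜 : List (Subset n)) → UpSet (upClosure 𝒜)
upClosure-upSet 𝒜 {x} {y} x⊆y =
  upClosure-intro {𝒜 = 𝒜} ∘ Any.map {P = _⊆ x} {Q = _⊆ y} (λ a⊆x → ⊆-trans a⊆x x⊆y) ∘ upClosure-elim

downClosure-downSet : (𝒜 : List (Subset n)) → DownSet (downClosure 𝒜)
downClosure-downSet 𝒜 {x} {y} x⊆y =
  downClosure-intro {𝒜 = 𝒜} ∘ Any.map {P = y ⊆_} {Q = x ⊆_} (⊆-trans x⊆y) ∘ downClosure-elim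

∈⇒upClosure∧downClosure : {𝒜 : List (Subset n)} {A : Subset n} →
  A ∈ 𝒜 → T (upClosure 𝒜 A ∧ downClosure 𝒜 A)
∈⇒upClosure∧downClosure A∈𝒜 =
  Equivalence.from T-∧ (upClosure-intro (lose A∈𝒜 ⊆-refl) , downClosure-intro (lose A∈𝒜 ⊆-refl))

length-bound : {𝒜 : List (Subset n)} → Unique 𝒜 →
  2 ^ n * length 𝒜 ≤ count (upClosure 𝒜) * count (downClosure 𝒜)
length-bound {n} {𝒜} unique = begin
  2 ^ n * length 𝒜
    ≤⟨ *-monoʳ-≤ (2 ^ n) (length≤count unique (All.tabulate ∈⇒upClosure∧downClosure)) ⟩
  2 ^ n * count (λ x → upClosure 𝒜 x ∧ downClosure 𝒜 x)
    ≤⟨ harris-kleitman (upClosure-upSet 𝒜) (downClosure-downSet 𝒜) ⟩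
  count (upClosure 𝒜) * count (downClosure 𝒜)
    ∎
  where open ≤-Reasoning

⊆∧⊆∁⇒∩≡⊥ : {p q r : Subset n} → p ⊆ r → q ⊆ ∁ r → p ∩ q ≡ ⊥
⊆∧⊆∁⇒∩≡⊥ {p = p} {q} p⊆r q⊆∁r = Empty-unique λ (i , i∈p∩q) →
  let i∈p , i∈q = x∈p∩q⁻ p q i∈p∩q in x∈p⇒x∉∁p (p⊆r i∈p) (q⊆∁r i∈q)

⊇∧⊇∁⇒∪≡⊤ : {p q r : Subset n} → r ⊆ p → ∁ r ⊆ q → p ∪ q ≡ ⊤
⊇∧⊇∁⇒∪≡⊤ {p = p} {q} {r} r⊆p ∁r⊆q = ⊆-antisym ⊆⊤ (⊆-trans (⊆-reflexive (sym (p∪∁p≡⊤ r))) r∪∁r⊆p∪q)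
  where
  r∪∁r⊆p∪q : r ∪ ∁ r ⊆ p ∪ q
  r∪∁r⊆p∪q i∈r∪∁r = x∈p∪q⁺ (Sum.map r⊆p ∁r⊆q (x∈p∪q⁻ r (∁ r) i∈r∪∁r))

CrossIU⇒upClosure-antipodal-free : {𝒜 ℬ : List (Subset n)} → CrossIU 𝒜 ℬ →
  ∀ x → T (upClosure 𝒜 x) → T (upClosure ℬ (∁ x)) → Empty
CrossIU⇒upClosure-antipodal-free cross x x∈U𝒜 ∁x∈Uℬ =
  let A , A∈𝒜 , A⊆x  = find (upClosure-elim x∈U𝒜)
      B , B∈ℬ , B⊆∁x = find (upClosure-elim ∁x∈Uℬ)
  in proj₁ (cross A∈𝒜 B∈ℬ) (⊆∧⊆∁⇒∩≡⊥ A⊆x B⊆∁x)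

CrossIU⇒downClosure-antipodal-free : {𝒜 ℬ : List (Subset n)} → CrossIU 𝒜 ℬ →
  ∀ x → T (downClosure 𝒜 x) → T (downClosure ℬ (∁ x)) → Empty
CrossIU⇒downClosure-antipodal-free cross x x∈D𝒜 ∁x∈Dℬ =
  let A , A∈𝒜 , x⊆A  = find (downClosure-elim x∈D𝒜)
      B , B∈ℬ , ∁x⊆B = find (downClosure-elim ∁x∈Dℬ)
  in proj₂ (cross A∈𝒜 B∈ℬ) (⊇∧⊇∁⇒∪≡⊤ x⊆A ∁x⊆B)

theorem9 : (n : ℕ) → 1 ≤ n → (𝒜 ℬ : List (Subset n)) → Unique 𝒜 → Unique ℬ →
    CrossIU 𝒜 ℬ → 2 ^ 4 * (length 𝒜 * length ℬ) ≤ 2 ^ (2 * n)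
theorem9 n _ 𝒜 ℬ unique𝒜 uniqueℬ cross =
  subst (2 ^ 4 * (length 𝒜 * length ℬ) ≤_) (sym 2^[2n]≡2^n*2^n)
    (product-bound {{m^n≢0 2 n}} u𝒜 uℬ d𝒜 dℬ (length-bound unique𝒜) (length-bound uniqueℬ) u-bound d-bound)
  where
  u𝒜 = count (upClosure 𝒜)
  uℬ = count (upClosure ℬ)
  d𝒜 = count (downClosure 𝒜)
  dℬ = count (downClosure ℬ)
  u-bound : u𝒜 + uℬ ≤ 2 ^ n
  u-bound = count-antipodal-free (CrossIU⇒upClosure-antipodal-free cross)
  d-bound : d𝒜 + dℬ ≤ 2 ^ n
  d-bound = count-antipodal-free (CrossIU⇒downClosure-antipodal-free cross)
  2^[2n]≡2^n*2^n : 2 ^ (2 * n) ≡ 2 ^ n * 2 ^ n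
  2^[2n]≡2^n*2^n = trans (^-distribˡ-+-* 2 n (n + 0)) (cong (λ k → 2 ^ n * 2 ^ k) (+-identityʳ n))
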